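{- Let $\Phi$ be a QCNF that fulfils the $XT$-property. Then no $XT$-clause can be derived by long-distance Q-resolution from $\Phi$.
   Context: A QCNF is $\Phi=\mathcal{Q}\cdot\phi$ with prefix $Q_1X_1\dots Q_sX_s$ (alternating quantifier blocks) and CNF matrix $\phi$ of non-tautological clauses; $\mathrm{lv}(x)=i$ if the variable of $x$ is in $X_i$. $\mathrm{red}(C)$ deletes from $C$ every universal literal $v$ with $\mathrm{lv}(v)>\mathrm{lv}(x)$ for all existential $x\in C$. A long-distance Q-resolution derivation from $\Phi$ is a sequence of clauses each of which is in $\phi$, or a resolvent $(C_1\vee x)\otimes_x(C_2\vee\bar x)=C_1\vee C_2$ of two earlier clauses over an existential literal $x$ (the variable of $x$ not otherwise occurring in the parents), which may contain complementary literals $u,\bar u$ only for universal $u$ and, if the variable $u$ occurs in both parents, only when $\mathrm{lv}(u)>\mathrm{lv}(x)$; or $\mathrm{red}(C)$ for an earlier clause $C$. $XT$-property. Let $\Phi=\exists X\forall U\exists T\cdot\phi$ with variable sets $X,U,T$. A clause $C$ is a $T$-clause if its variables meet $T$ but not $X$ or $U$; an $XT$-clause if its variables meet $X$ and $T$ but not $U$. $\Phi$ fulfils the $XT$-property if $\phi$ contains no $XT$-clause, no unit (one-literal) $T$-clause, and no two $T$-clauses that are resolvable (contain a complementary pair of literals). -}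

module Defs where

open import Data.Nat using (ℕ; _<_; _<?_)
import Data.Nat as ℕ
open import Data.Bool using (Bool; true; false; not)
open import Data.List using (List; []; _∷_; filter; _++_)
open import Data.List.Membership.Propositional using (_∈_; _∉_)
open import Data.List.Relation.Unary.All using (All; all?)
open import Data.List.Relation.Unary.Any using (Any)
open import Data.Product using (Σ; _×_; _,_)
open import Data.Empty using (⊥)
open import Relation.Nullary using (¬_; Dec; yes; no)
open import Relation.Nullary.Decidable using (¬?; _×-dec_; _→-dec_)
open import Relation.Binary.PropositionalEquality using (_≡_; _≢_; refl)

data Block : Set where
  bX bU bT : Block

_≟B_ : (a b : Block) → Dec (a ≡ b)
bX ≟B bX = yes refl
bX ≟B bU = no λ ()
bX ≟B bT = no λ ()
bU ≟B bX = no λ ()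
bU ≟B bU = yes refl
bU ≟B bT = no λ ()
bT ≟B bX = no λ ()
bT ≟B bU = no λ ()
bT ≟B bT = yes refl

blockLevel : Block → ℕ
blockLevel bX = 1
blockLevel bU = 2
blockLevel bT = 3

record Lit : Set where
  constructor lit
  field
    var : ℕ
    pos : Bool
open Lit public

neg : Lit → Lit
neg (lit v b) = lit v (not b)

-- a clause is a list of literals, read as the set of its members
Clause : Set
Clause = List Lit

-- A QCNF  ∃X ∀U ∃T · φ : the prefix is given by assigning each variable
-- its block, the matrix is a list of clauses.

record QCNF : Set where
  constructor qcnf
  field
    blk    : ℕ → Block
    matrix : List Clause
open QCNF public

module _ (Φ : QCNF) where

  lv : Lit → ℕ
  lv l = blockLevel (blk Φ (var l))

  Universal : Lit → Set
  Universal l = blk Φ (var l) ≡ bU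

  Existential : Lit → Set
  Existential l = ¬ Universal l

  Universal? : (l : Lit) → Dec (Universal l)
  Universal? l = blk Φ (var l) ≟B bU

  Tautological : Clause → Set
  Tautological C = Σ Lit λ l → l ∈ C × neg l ∈ C

  Reducible : Clause → Lit → Set
  Reducible C v = Universal v × All (λ x → Existential x → lv x < lv v) C

  Reducible? : (C : Clause) (v : Lit) → Dec (Reducible C v)
  Reducible? C v = Universal? v ×-dec all? (λ x → ¬? (Universal? x) →-dec (lv x <? lv v)) C

  red : Clause → Clause
  red C = filter (λ v → ¬? (Reducible? C v)) C

  resolvent : Lit → Clause → Clause → Clause
  resolvent x C₁ C₂ =
    filter (λ l → ¬? (var l ℕ.≟ var x)) C₁ ++ filter (λ l → ¬? (var l ℕ.≟ var x)) C₂

  OccursIn : ℕ → Clause → Set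
  OccursIn v C = Any (λ l → var l ≡ v) C

  LDOk : Lit → Clause → Clause → Set
  LDOk x C₁ C₂ = ∀ u → u ∈ resolvent x C₁ C₂ → neg u ∈ resolvent x C₁ C₂ →
    Universal u × (OccursIn (var u) C₁ → OccursIn (var u) C₂ → lv x < lv u)

  data Derivable : Clause → Set where
    axiom : ∀ {C} → C ∈ matrix Φ → Derivable C
    resolve : ∀ {C₁ C₂} (x : Lit) →
      Derivable C₁ → Derivable C₂ →
      Existential x →
      x ∈ C₁ → neg x ∈ C₂ →
      neg x ∉ C₁ → x ∉ C₂ →
      LDOk x C₁ C₂ →
      Derivable (resolvent x C₁ C₂)
    reduce : ∀ {C} → Derivable C → Derivable (red C)

  InBlock : Block → Lit → Set
  InBlock b l = blk Φ (var l) ≡ b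

  TClause : Clause → Set
  TClause C = Any (InBlock bT) C × All (λ l → ¬ InBlock bX l) C × All (λ l → ¬ InBlock bU l) C

  XTClause : Clause → Set
  XTClause C = Any (InBlock bX) C × Any (InBlock bT) C × All (λ l → ¬ InBlock bU l) C

  Unit : Clause → Set
  Unit C = Σ Lit λ l → l ∈ C × All (λ m → m ≡ l) C

  Resolvable : Clause → Clause → Set
  Resolvable C D = Σ Lit λ l → l ∈ C × neg l ∈ D

  WellFormed : Set
  WellFormed = ∀ C → C ∈ matrix Φ → ¬ Tautological C

  XTProperty : Set
  XTProperty =
    (∀ C → C ∈ matrix Φ → ¬ XTClause C) ×
    (∀ C → C ∈ matrix Φ → TClause C → ¬ Unit C) ×
    (∀ C D → C ∈ matrix Φ → D ∈ matrix Φ → TClause C → TClause D → ¬ Resolvable C D)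

-- A derived clause without universal literals that contains a T-literal is
-- contained in a T-clause of the matrix.  For an axiom this is exactly the
-- absence of XT-clauses.  A reduction step cannot remove anything from such a
-- clause, since no universal literal lies to the right of T.  A resolvent
-- cannot have this shape at all: its parents are again universal-free, so by
-- induction the parent carrying the T-literal lies in a T-clause, which puts
-- the pivot into T; then both parents lie in T-clauses that are resolvable on
-- the pivot.  An XT-clause, having an X-literal, lies in no T-clause.
module Submission where

open import Defs
open import Data.Nat using (_≤_; _<_; z≤n; s≤s)
import Data.Nat as ℕ
open import Data.Nat.Properties using (<⇒≱)
open import Data.List using (filter)
open import Data.List.Membership.Propositional using (_∈_; find; lose)
open import Data.List.Membership.Propositional.Properties using (∈-++⁺ˡ; ∈-++⁺ʳ; ∈-++⁻; ∈-filter⁺; ∈-filter⁻)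
open import Data.List.Relation.Binary.Subset.Propositional using (_⊆_)
open import Data.List.Relation.Binary.Subset.Propositional.Properties using (Any-resp-⊆)
open import Data.List.Properties using (filter-all)
open import Data.List.Relation.Unary.All as All using (All)
open import Data.List.Relation.Unary.All.Properties using (¬Any⇒All¬)
open import Data.List.Relation.Unary.Any as Any using (Any)
open import Data.Product using (Σ; _×_; _,_; proj₁)
open import Data.Sum using (_⊎_; inj₁; inj₂)
open import Data.Empty using (⊥-elim)
open import Relation.Nullary using (¬_; yes; no; ¬?)
open import Relation.Binary.PropositionalEquality using (_≡_; _≢_; refl; sym; trans; cong; subst)

blockLevel≤3 : ∀ b → blockLevel b ≤ 3
blockLevel≤3 bX = s≤s z≤n
blockLevel≤3 bU = s≤s (s≤s z≤n)
blockLevel≤3 bT = s≤s (s≤s (s≤s z≤n))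

≢bX∧≢bU⇒≡bT : ∀ {b} → b ≢ bX → b ≢ bU → b ≡ bT
≢bX∧≢bU⇒≡bT {bX} b≢bX _ = ⊥-elim (b≢bX refl)
≢bX∧≢bU⇒≡bT {bU} _ b≢bU = ⊥-elim (b≢bU refl)
≢bX∧≢bU⇒≡bT {bT} _ _    = refl

module _ (Φ : QCNF) where

  UniversalFree : Clause → Set
  UniversalFree = All (λ l → ¬ InBlock Φ bU l)

  TClause⇒InBlock-bT : ∀ {D l} → TClause Φ D → l ∈ D → InBlock Φ bT l
  TClause⇒InBlock-bT (_ , noX , noU) l∈D =
    ≢bX∧≢bU⇒≡bT (All.lookup noX l∈D) (All.lookup noU l∈D)

  InBlock-bT⇒Existential : ∀ {l} → InBlock Φ bT l → Existential Φ l
  InBlock-bT⇒Existential lT lU with trans (sym lT) lU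
  ... | ()

  red-⊆ : ∀ {C} → red Φ C ⊆ C
  red-⊆ {C} l∈ = proj₁ (∈-filter⁻ (λ v → ¬? (Reducible? Φ C v)) l∈)

  InBlock-bT⇒¬Reducible : ∀ {C t} → t ∈ C → InBlock Φ bT t → ∀ v → ¬ Reducible Φ C v
  InBlock-bT⇒¬Reducible {t = t} t∈C tT v (_ , leftOfV) =
    <⇒≱ (subst (_< lv Φ v) (cong blockLevel tT) t<v) (blockLevel≤3 (blk Φ (var v)))
    where t<v = All.lookup leftOfV t∈C (InBlock-bT⇒Existential {t} tT)

  red-InBlock-bT : ∀ {C} → Any (InBlock Φ bT) C → red Φ C ≡ C
  red-InBlock-bT {C} anyT with find anyT
  ... | t , t∈C , tT =
    filter-all (λ v → ¬? (Reducible? Φ C v)) (All.universal (InBlock-bT⇒¬Reducible t∈C tT) C)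

  module _ (x : Lit) (C₁ C₂ : Clause) where

    private
      keep? = λ (l : Lit) → ¬? (var l ℕ.≟ var x)

    ∈-resolvent⁺ˡ : ∀ {l} → l ∈ C₁ → var l ≢ var x → l ∈ resolvent Φ x C₁ C₂
    ∈-resolvent⁺ˡ l∈ l≢x = ∈-++⁺ˡ (∈-filter⁺ keep? l∈ l≢x)

    ∈-resolvent⁺ʳ : ∀ {l} → l ∈ C₂ → var l ≢ var x → l ∈ resolvent Φ x C₁ C₂
    ∈-resolvent⁺ʳ l∈ l≢x = ∈-++⁺ʳ (filter keep? C₁) (∈-filter⁺ keep? l∈ l≢x)

    ∈-resolvent⁻ : ∀ {l} → l ∈ resolvent Φ x C₁ C₂ → l ∈ C₁ ⊎ l ∈ C₂
    ∈-resolvent⁻ l∈ with ∈-++⁻ (filter keep? C₁) l∈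
    ... | inj₁ l∈₁ = inj₁ (proj₁ (∈-filter⁻ keep? l∈₁))
    ... | inj₂ l∈₂ = inj₂ (proj₁ (∈-filter⁻ keep? l∈₂))

  UniversalFree-parent : ∀ x {C R} → Existential Φ x →
    (∀ {l} → l ∈ C → var l ≢ var x → l ∈ R) → UniversalFree R → UniversalFree C
  UniversalFree-parent x {C} x∃ C⊆R R-free = All.tabulate notU
    where
    notU : ∀ {l} → l ∈ C → ¬ InBlock Φ bU l
    notU {l} l∈C with var l ℕ.≟ var x
    ... | yes refl = x∃
    ... | no l≢x  = All.lookup R-free (C⊆R l∈C l≢x)

  SubsumedByTClause : Clause → Set
  SubsumedByTClause C = Σ Clause λ D → D ∈ matrix Φ × TClause Φ D × C ⊆ D

  Invariant : Clause → Set
  Invariant C = UniversalFree C → Any (InBlock Φ bT) C → SubsumedByTClause C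

  module _
    (no-XT-axiom : ∀ C → C ∈ matrix Φ → ¬ XTClause Φ C)
    (T-irresolvable : ∀ C D → C ∈ matrix Φ → D ∈ matrix Φ →
                        TClause Φ C → TClause Φ D → ¬ Resolvable Φ C D)
    where

    axiom-invariant : ∀ {C} → C ∈ matrix Φ → Invariant C
    axiom-invariant {C} C∈ C-free anyT with Any.any? (λ l → blk Φ (var l) ≟B bX) C
    ... | yes anyX = ⊥-elim (no-XT-axiom C C∈ (anyX , anyT , C-free))
    ... | no ¬anyX = C , C∈ , (anyT , ¬Any⇒All¬ C ¬anyX , C-free) , λ l∈ → l∈

    resolvent-without-T : ∀ {x C₁ C₂} → Existential Φ x → x ∈ C₁ → neg x ∈ C₂ →
      Invariant C₁ → Invariant C₂ →
      UniversalFree (resolvent Φ x C₁ C₂) → ¬ Any (InBlock Φ bT) (resolvent Φ x C₁ C₂)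
    resolvent-without-T {x} {C₁} {C₂} x∃ x∈C₁ x̄∈C₂ inv₁ inv₂ R-free anyT =
      pivot-not-T (pivot-in-T (find anyT))
      where
      C₁-free : UniversalFree C₁
      C₁-free = UniversalFree-parent x x∃ (∈-resolvent⁺ˡ x C₁ C₂) R-free
      C₂-free : UniversalFree C₂
      C₂-free = UniversalFree-parent x x∃ (∈-resolvent⁺ʳ x C₁ C₂) R-free

      -- InBlock sees only the variable, so a T-literal x̄ makes x a T-literal.
      pivot-in-T : Σ Lit (λ t → t ∈ resolvent Φ x C₁ C₂ × InBlock Φ bT t) → InBlock Φ bT x
      pivot-in-T (t , t∈R , tT) with ∈-resolvent⁻ x C₁ C₂ t∈R
      ... | inj₁ t∈C₁ = let _ , _ , D₁T , C₁⊆D₁ = inv₁ C₁-free (lose t∈C₁ tT)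
                        in TClause⇒InBlock-bT D₁T (C₁⊆D₁ x∈C₁)
      ... | inj₂ t∈C₂ = let _ , _ , D₂T , C₂⊆D₂ = inv₂ C₂-free (lose t∈C₂ tT)
                        in TClause⇒InBlock-bT D₂T (C₂⊆D₂ x̄∈C₂)

      pivot-not-T : ¬ InBlock Φ bT x
      pivot-not-T xT =
        let D₁ , D₁∈ , D₁T , C₁⊆D₁ = inv₁ C₁-free (lose x∈C₁ xT)
            D₂ , D₂∈ , D₂T , C₂⊆D₂ = inv₂ C₂-free (lose x̄∈C₂ xT)
        in T-irresolvable D₁ D₂ D₁∈ D₂∈ D₁T D₂T (x , C₁⊆D₁ x∈C₁ , C₂⊆D₂ x̄∈C₂)

    derivable-invariant : ∀ {C} → Derivable Φ C → Invariant C
    derivable-invariant (axiom C∈) = axiom-invariant C∈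
    derivable-invariant (resolve x d₁ d₂ x∃ x∈ x̄∈ _ _ _) R-free anyT =
      ⊥-elim (resolvent-without-T x∃ x∈ x̄∈
        (derivable-invariant d₁) (derivable-invariant d₂) R-free anyT)
    derivable-invariant (reduce d) C-free anyT =
      subst Invariant (sym (red-InBlock-bT (Any-resp-⊆ red-⊆ anyT)))
        (derivable-invariant d) C-free anyT

lemma5p3 : (Φ : QCNF) → WellFormed Φ → XTProperty Φ →
    ∀ C → Derivable Φ C → ¬ XTClause Φ C
lemma5p3 Φ _ (no-XT-axiom , _ , T-irresolvable) C d (anyX , anyT , C-free)
  with derivable-invariant Φ no-XT-axiom T-irresolvable d C-free anyT
... | _ , _ , (_ , noX , _) , C⊆D with find anyX
... | y , y∈C , yX = All.lookup noX (C⊆D y∈C) yX
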